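{- In every 2-ball colored juggling pattern (closed walk in the 2-ball colored state graph), the number of $C_2$ beats in one period is even.
   Context: The two balls have distinct colors, orange and blue. A 2-ball colored state is an ordered pair $(x,y)$ of distinct positive integers, $x$ being the number of beats until the orange ball lands and $y$ the number until the blue ball lands. Transitions: from $(x,y)$ with $x,y\ge2$ the only transition is to $(x-1,y-1)$; from $(1,y)$ the transitions are to $(z,y-1)$ for every positive integer $z\ne y-1$; from $(x,1)$ the transitions are to $(x-1,z)$ for every positive integer $z\neq x-1$. A colored juggling pattern is a closed walk in this directed graph. A beat (transition) is a $C_2$ beat if a ball lands and is thrown so that it lands after the other ball, i.e. it is $(1,y)\to(z,y-1)$ with $z>y-1$ or $(x,1)\to(x-1,z)$ with $z>x-1$. -}

module Defs where

open import Data.Nat using (ℕ; zero; suc; _+_; _>_; _≟_; _<?_)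

open import Relation.Nullary using (¬_; yes; no)
open import Relation.Binary.PropositionalEquality using (_≡_; _≢_)

-- A 2-ball colored state (x , y): x = beats until the orange ball lands,
-- y = beats until the blue ball lands; x, y positive and distinct.
record State : Set where
  constructor st
  field
    x   : ℕ
    y   : ℕ
    x>0 : x > 0
    y>0 : y > 0
    x≢y : x ≢ y

open State public

-- The transitions (edges) of the 2-ball colored state graph.
-- Positivity and distinctness of the target are part of State.
data Step : State → State → Set where
  advance : ∀ {s t} → x s ≡ suc (x t) → y s ≡ suc (y t) → Step s t
  -- (1,y) → (z, y-1) with z ≠ y-1 : the orange ball is rethrown to land in z beats
  throwO  : ∀ {s t} → x s ≡ 1 → y s ≡ suc (y t) → Step s t
  -- (x,1) → (x-1, z) with z ≠ x-1 : the blue ball is rethrown to land in z beats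
  throwB  : ∀ {s t} → y s ≡ 1 → x s ≡ suc (x t) → Step s t

-- C₂-indicator of a beat: 1 if a ball lands and is rethrown so that it lands
-- after the other ball, 0 otherwise.
c2 : ∀ {s t} → Step s t → ℕ
c2 (advance _ _) = 0
c2 {t = t} (throwO _ _) with y t <? x t
... | yes _ = 1
... | no  _ = 0
c2 {t = t} (throwB _ _) with x t <? y t
... | yes _ = 1
... | no  _ = 0

data Walk : State → State → Set where
  []  : ∀ {s} → Walk s s
  _∷_ : ∀ {s t u} → Step s t → Walk t u → Walk s u

len : ∀ {s t} → Walk s t → ℕ
len []      = 0
len (_ ∷ w) = suc (len w)

countC2 : ∀ {s t} → Walk s t → ℕ
countC2 []      = 0
countC2 (e ∷ w) = c2 e + countC2 w

{-# OPTIONS --safe #-}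
module Submission where

-- The C₂ beats are exactly the beats at which the landing order of the two balls flips.
-- Advancing preserves the order, and a throw is always made with the ball that lands
-- first, so it flips the order precisely when that ball is sent to land after the other.
-- Along a closed walk the landing order returns to its initial value, hence flips an
-- even number of times.

open import Defs
open import Data.Bool.Base using (if_then_else_)
open import Function.Base using (_∘_)
open import Data.Nat.Base using (ℕ; zero; suc; _≤_; _<_; _>_; parity)
open import Data.Nat.Properties using (_<?_; <-asym; ≮⇒≥; ≤∧≢⇒<)
open import Data.Nat.Divisibility using (_∣_; _∣0; ∣-refl; ∣m∣n⇒∣m+n)
open import Data.Parity.Base using (Parity; 0ℙ; 1ℙ; _+_)
open import Data.Parity.Properties using (+-assoc; +-identityˡ; p+p≡0ℙ; +-homo-+)
open import Relation.Nullary using (¬_; yes; no)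
open import Relation.Nullary.Decidable using (does; dec-true; dec-false)
open import Relation.Binary.PropositionalEquality
open ≡-Reasoning

+-telescope : ∀ p q r → (p + q) + (q + r) ≡ p + r
+-telescope p q r = begin
  (p + q) + (q + r)  ≡⟨ +-assoc p q (q + r) ⟩
  p + (q + (q + r))  ≡⟨ cong (p +_) (sym (+-assoc q q r)) ⟩
  p + ((q + q) + r)  ≡⟨ cong (λ o → p + (o + r)) (p+p≡0ℙ q) ⟩
  p + (0ℙ + r)       ≡⟨ cong (p +_) (+-identityˡ r) ⟩
  p + r              ∎

parity≡0ℙ⇒2∣ : ∀ n → parity n ≡ 0ℙ → 2 ∣ n
parity≡0ℙ⇒2∣ zero          _  = 2 ∣0
parity≡0ℙ⇒2∣ (suc zero)    ()
parity≡0ℙ⇒2∣ (suc (suc n)) eq = ∣m∣n⇒∣m+n ∣-refl (parity≡0ℙ⇒2∣ n eq)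

precedence : ℕ → ℕ → Parity
precedence m n = if does (m <? n) then 0ℙ else 1ℙ

precedence-< : ∀ {m n} → m < n → precedence m n ≡ 0ℙ
precedence-< {m} {n} m<n rewrite dec-true (m <? n) m<n = refl

precedence-> : ∀ {m n} → n < m → precedence m n ≡ 1ℙ
precedence-> {m} {n} n<m rewrite dec-false (m <? n) (<-asym n<m) = refl

landingOrder : State → Parity
landingOrder s = precedence (x s) (y s)

orange-lands-first : ∀ s → x s ≡ 1 → x s < y s
orange-lands-first s x≡1 = ≤∧≢⇒< (subst (_≤ y s) (sym x≡1) (y>0 s)) (x≢y s)

blue-lands-first : ∀ s → y s ≡ 1 → y s < x s
blue-lands-first s y≡1 = ≤∧≢⇒< (subst (_≤ x s) (sym y≡1) (x>0 s)) (x≢y s ∘ sym)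

orange-first-unless-blue-first : ∀ s → ¬ (y s < x s) → x s < y s
orange-first-unless-blue-first s y≮x = ≤∧≢⇒< (≮⇒≥ y≮x) (x≢y s)

blue-first-unless-orange-first : ∀ s → ¬ (x s < y s) → y s < x s
blue-first-unless-orange-first s x≮y = ≤∧≢⇒< (≮⇒≥ x≮y) (x≢y s ∘ sym)

advance-preserves-landingOrder : ∀ {s t} → x s ≡ suc (x t) → y s ≡ suc (y t) →
                                 landingOrder s ≡ landingOrder t
advance-preserves-landingOrder x≡ y≡ = cong₂ precedence x≡ y≡

c2-flips-landingOrder : ∀ {s t} (e : Step s t) → parity (c2 e) ≡ landingOrder s + landingOrder t
c2-flips-landingOrder {s} {t} (advance x≡ y≡)
  rewrite advance-preserves-landingOrder {s} {t} x≡ y≡ = sym (p+p≡0ℙ (landingOrder t))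
c2-flips-landingOrder {s} {t} (throwO x≡1 _) with y t <? x t
... | yes y<x
  rewrite precedence-< (orange-lands-first s x≡1) | precedence-> y<x = refl
... | no y≮x
  rewrite precedence-< (orange-lands-first s x≡1)
        | precedence-< (orange-first-unless-blue-first t y≮x) = refl
c2-flips-landingOrder {s} {t} (throwB y≡1 _) with x t <? y t
... | yes x<y
  rewrite precedence-> (blue-lands-first s y≡1) | precedence-< x<y = refl
... | no x≮y
  rewrite precedence-> (blue-lands-first s y≡1)
        | precedence-> (blue-first-unless-orange-first t x≮y) = refl

countC2-parity : ∀ {s u} (w : Walk s u) → parity (countC2 w) ≡ landingOrder s + landingOrder u
countC2-parity {s} [] = sym (p+p≡0ℙ (landingOrder s))
countC2-parity {s} {u} (_∷_ {t = t} e w) = begin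
  parity (countC2 (e ∷ w))            ≡⟨ +-homo-+ (c2 e) (countC2 w) ⟩
  parity (c2 e) + parity (countC2 w)  ≡⟨ cong₂ _+_ (c2-flips-landingOrder e) (countC2-parity w) ⟩
  (oₛ + oₜ) + (oₜ + oᵤ)               ≡⟨ +-telescope oₛ oₜ oᵤ ⟩
  oₛ + oᵤ                             ∎
  where
  oₛ oₜ oᵤ : Parity
  oₛ = landingOrder s
  oₜ = landingOrder t
  oᵤ = landingOrder u

lemma4p1 : (s : State) (w : Walk s s) → len w > 0 → 2 ∣ countC2 w
lemma4p1 s w _ =
  parity≡0ℙ⇒2∣ (countC2 w) (trans (countC2-parity w) (p+p≡0ℙ (landingOrder s)))
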